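{- Let $r\ge1$ and let $I,J,K\subseteq[1,r]$ be subsets of the same cardinality $s$. If $(I,J,K)$ is $LR$-consistent, then $$\#(I_{>i})\ \ge\ \#(J_{>r-j})+\#(K_{>r-k})$$ for all integer triples $(i,j,k)$ with $0\le i,j,k<r$ and $i+j+k=r$.
   Context: $[1,r]=\{1,\dots,r\}$. For a subset $I=\{i_1<\dots<i_s\}\subseteq[1,r]$, $\rho(I)$ is the partition $(i_s-s,\dots,i_2-2,i_1-1)$; $\#(I_{>i})$ denotes the number of elements of $I$ greater than $i$. For $s\ge1$, $P_s$ is the set of partitions of length $\le s$, and $LR_s=\{(\lambda,\mu,\nu)\in P_s^3: c^\lambda_{\mu\nu}>0\}$, where $c^\lambda_{\mu\nu}$ is the Littlewood–Richardson coefficient (the multiplicity of the irreducible polynomial $GL_s(\mathbb{C})$-representation $V_\lambda$ in $V_\mu\otimes V_\nu$). A triple $(I,J,K)$ of subsets of $[1,r]$ of common cardinality $s$ is $LR$-consistent if $(\rho(I),\rho(J),\rho(K))\in LR_s$. -}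

module Defs where

open import Data.Nat using (ℕ; zero; suc; _+_; _∸_; _≤_; _<_; _<?_)
open import Data.Nat.Properties using (_≟_)
open import Data.Bool using (Bool; true; false)
open import Data.List using (List; []; _∷_; length; filter; map; reverse; upTo; concatMap; take)
open import Data.Vec using (Vec; []; _∷_)
open import Data.Fin.Subset using (Subset)
open import Data.Product using (Σ; _×_)
open import Relation.Binary.PropositionalEquality using (_≡_)

-- Elements (1-based, increasing) of a subset of [1,r] given as a
-- characteristic vector; the argument p is the label of the first slot.
elemsFrom : ∀ {n} → ℕ → Subset n → List ℕ
elemsFrom p [] = []
elemsFrom p (true ∷ v) = p ∷ elemsFrom (suc p) v
elemsFrom p (false ∷ v) = elemsFrom (suc p) v

elems : ∀ {r} → Subset r → List ℕ
elems = elemsFrom 1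

countGt : ∀ {r} → Subset r → ℕ → ℕ
countGt I i = length (filter (i <?_) (elems I))

rhoAux : List ℕ → ℕ → List ℕ
rhoAux [] t = []
rhoAux (x ∷ xs) t = (x ∸ t) ∷ rhoAux xs (suc t)

ρ : ∀ {r} → Subset r → List ℕ
ρ I = reverse (rhoAux (elems I) 1)

-- Partitions (as lists, entries beyond the length are 0)

get : List ℕ → ℕ → ℕ
get [] _ = 0
get (x ∷ xs) zero = x
get (x ∷ xs) (suc n) = get xs n

InP : ℕ → List ℕ → Set
InP s lam = (length lam ≤ s) × (∀ a → get lam (suc a) ≤ get lam a)

range : ℕ → ℕ → List ℕ
range m n = map (m +_) (upTo (n ∸ m))

count : ℕ → List ℕ → ℕ
count v w = length (filter (_≟ v) w)

-- A filling T (row a, column c ↦ entry, entries 0-based: value v stands for v+1)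
-- of the skew shape λ/μ with rows 0..s-1.
-- Reverse reading word: rows top to bottom, each row read right to left.
readingWord : ℕ → List ℕ → List ℕ → (ℕ → ℕ → ℕ) → List ℕ
readingWord s lam mu T =
  concatMap (λ a → reverse (map (T a) (range (get mu a) (get lam a)))) (upTo s)

record IsLRTableau (s : ℕ) (lam mu nu : List ℕ) (T : ℕ → ℕ → ℕ) : Set where
  field
    entries<s   : ∀ a c → a < s → get mu a ≤ c → c < get lam a → T a c < s
    rowsWeak    : ∀ a c → a < s → get mu a ≤ c → suc c < get lam a →
                  T a c ≤ T a (suc c)
    colsStrict  : ∀ a c → suc a < s → get mu a ≤ c → get mu (suc a) ≤ c →
                  c < get lam (suc a) → T a c < T (suc a) c
    content     : ∀ v → v < s → count v (readingWord s lam mu T) ≡ get nu v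
    lattice     : ∀ n v → suc v < s →
                  count (suc v) (take n (readingWord s lam mu T)) ≤
                  count v (take n (readingWord s lam mu T))

-- c^λ_{μν} > 0 : μ ⊆ λ and an LR tableau of shape λ/μ with content ν exists
LRpos : ℕ → List ℕ → List ℕ → List ℕ → Set
LRpos s lam mu nu =
  (∀ a → get mu a ≤ get lam a) × Σ (ℕ → ℕ → ℕ) (IsLRTableau s lam mu nu)

InLR : ℕ → List ℕ → List ℕ → List ℕ → Set
InLR s lam mu nu = InP s lam × InP s mu × InP s nu × LRpos s lam mu nu

LRConsistent : ∀ {r} → ℕ → Subset r → Subset r → Subset r → Set
LRConsistent s I J K = InLR s (ρ I) (ρ J) (ρ K)

{-# OPTIONS --safe #-}
-- Write λ = ρ(I), μ = ρ(J), ν = ρ(K), with parts and tableau letters indexed from 0.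
-- Since ρ(X)_m + s − m is the (m+1)-st largest element of X, #(X_{>t}) ≥ m + 1 iff
-- t + m + 1 ≤ ρ(X)_m + s. As r − j = i + k and r − k = i + j, adding such thresholds
-- reduces the claim to λ_0 + s ≤ r and three facts about an LR triple:
--   μ ⊆ λ,   ν ⊆ λ,   μ_p + ν_q ≤ λ_0 + λ_{p+q+1}.
-- The last two come from an LR tableau of shape λ/μ and content ν. In each row the entries
-- ≥ v form a right segment, and column strictness moves its left end weakly leftwards
-- down the rows; hence the letters v in rows ≥ m sit in distinct columns of row m, and
-- ν_v ≤ #(v in rows < m) + λ_m. For v = 0 the segment of row a starts at μ_a, which gives
-- #(0 in the first p + 1 rows) ≤ λ_0 − μ_p; and the lattice condition gives
-- #(q in the first p + q rows) ≤ #(0 in the first p rows).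
module Submission where

open import Defs
open import Data.Nat using (ℕ; _+_; _∸_; _≤_; _<_; _≥_)
open import Data.Fin.Subset using (Subset; ∣_∣)
open import Relation.Binary.PropositionalEquality using (_≡_)

open import Data.Nat using (_≮_; zero; suc; z≤n; s≤s; s≤s⁻¹; z<s; _≤′_; ≤′-refl; ≤′-step; _≤?_; _<?_)
open import Data.Nat.Properties
open import Data.Nat.Tactic.RingSolver using (solve-∀)
open import Algebra.Properties.CommutativeSemigroup +-commutativeSemigroup using (interchange; xy∙z≈xz∙y)
open import Data.Bool using (true; false)
open import Data.List using (List; []; _∷_; _++_; [_]; length; filter; map; reverse; applyUpTo; upTo; concatMap; take)
open import Data.List.Properties
  using (length-++; filter-++; filter-accept; filter-reject; filter-none; length-filter; ++-assoc; ++-identityʳ;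
         reverse-++; concatMap-++; map-++; map-upTo; upTo-∷ʳ; length-reverse; unfold-reverse)
open import Data.List.Relation.Unary.All as All using (All; []; _∷_)
open import Data.List.Relation.Binary.Permutation.Propositional.Properties using (↭-length; filter-↭; ↭-reverse)
open import Data.Vec using ([]; _∷_)
open import Data.Product using (_×_; _,_; proj₁; proj₂; ∃; ∃₂)
open import Data.Sum using (inj₁; inj₂)
open import Data.Empty using (⊥-elim)
open import Function using (_∘_)
open import Function.Bundles using (_⇔_; mk⇔; Equivalence)
open import Relation.Nullary using (yes; no)
open import Relation.Binary.PropositionalEquality using (refl; sym; trans; cong; cong₂; subst; subst₂; _≢_; module ≡-Reasoning)

count-accept : ∀ {v x} xs → x ≡ v → count v (x ∷ xs) ≡ suc (count v xs)
count-accept {v} xs x≡v = cong length (filter-accept (_≟ v) {xs = xs} x≡v)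

count-reject : ∀ {v x} xs → x ≢ v → count v (x ∷ xs) ≡ count v xs
count-reject {v} xs x≢v = cong length (filter-reject (_≟ v) {xs = xs} x≢v)

count-++ : ∀ v xs ys → count v (xs ++ ys) ≡ count v xs + count v ys
count-++ v xs ys = trans (cong length (filter-++ (_≟ v) xs ys)) (length-++ (filter (_≟ v) xs))

count-reverse : ∀ v xs → count v (reverse xs) ≡ count v xs
count-reverse v xs = ↭-length (filter-↭ (_≟ v) (↭-reverse xs))

count-none : ∀ {v xs} → All (_≢ v) xs → count v xs ≡ 0
count-none {v} xs≢v = cong length (filter-none (_≟ v) xs≢v)

take-length-++ : ∀ {A : Set} (xs ys : List A) → take (length xs) (xs ++ ys) ≡ xs
take-length-++ []       ys = refl
take-length-++ (x ∷ xs) ys = cong (x ∷_) (take-length-++ xs ys)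

interval : ℕ → ℕ → List ℕ
interval lo zero    = []
interval lo (suc n) = lo ∷ interval (suc lo) n

applyUpTo≡interval : ∀ (f : ℕ → ℕ) lo n → (∀ x → f x ≡ lo + x) → applyUpTo f n ≡ interval lo n
applyUpTo≡interval f lo zero    f≗ = refl
applyUpTo≡interval f lo (suc n) f≗ =
  cong₂ _∷_ (trans (f≗ 0) (+-identityʳ lo))
            (applyUpTo≡interval (f ∘ suc) (suc lo) n (λ x → trans (f≗ (suc x)) (+-suc lo x)))

range≡interval : ∀ m n → range m n ≡ interval m (n ∸ m)
range≡interval m n = trans (map-upTo (m +_) (n ∸ m)) (applyUpTo≡interval (m +_) m (n ∸ m) (λ _ → refl))

interval-++ : ∀ lo x y → interval lo (x + y) ≡ interval lo x ++ interval (lo + x) y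
interval-++ lo zero    y = cong (λ l → interval l y) (sym (+-identityʳ lo))
interval-++ lo (suc x) y = cong (lo ∷_) (trans (interval-++ (suc lo) x y)
                                                (cong (λ l → interval (suc lo) x ++ interval l y) (sym (+-suc lo x))))

interval-split : ∀ {lo g hi} → lo ≤ g → g ≤ hi → interval lo (hi ∸ lo) ≡ interval lo (g ∸ lo) ++ interval g (hi ∸ g)
interval-split {lo} {g} {hi} lo≤g g≤hi = begin
  interval lo (hi ∸ lo)                                      ≡⟨ cong (interval lo) length≡ ⟩
  interval lo ((g ∸ lo) + (hi ∸ g))                          ≡⟨ interval-++ lo (g ∸ lo) (hi ∸ g) ⟩
  interval lo (g ∸ lo) ++ interval (lo + (g ∸ lo)) (hi ∸ g)  ≡⟨ cong (λ l → interval lo (g ∸ lo) ++ interval l (hi ∸ g))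
                                                                     (m+[n∸m]≡n lo≤g) ⟩
  interval lo (g ∸ lo) ++ interval g (hi ∸ g)                ∎
  where
  open ≡-Reasoning
  length≡ : hi ∸ lo ≡ (g ∸ lo) + (hi ∸ g)
  length≡ = +-cancelˡ-≡ lo _ _ (begin
    lo + (hi ∸ lo)              ≡⟨ m+[n∸m]≡n (≤-trans lo≤g g≤hi) ⟩
    hi                          ≡⟨ sym (m+[n∸m]≡n g≤hi) ⟩
    g + (hi ∸ g)                ≡⟨ cong (_+ (hi ∸ g)) (sym (m+[n∸m]≡n lo≤g)) ⟩
    lo + (g ∸ lo) + (hi ∸ g)    ≡⟨ +-assoc lo (g ∸ lo) (hi ∸ g) ⟩
    lo + ((g ∸ lo) + (hi ∸ g))  ∎)

All-map-interval : ∀ {P : ℕ → Set} (f : ℕ → ℕ) lo n →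
  (∀ c → lo ≤ c → c < lo + n → P (f c)) → All P (map f (interval lo n))
All-map-interval f lo zero    Pf = []
All-map-interval f lo (suc n) Pf =
  Pf lo ≤-refl (m<m+n lo z<s) ∷
  All-map-interval f (suc lo) n (λ c lo<c c<end → Pf c (<⇒≤ lo<c) (subst (c <_) (sym (+-suc lo n)) c<end))

count-map-interval+≤ : ∀ v (f : ℕ → ℕ) lo n {g b} → g ≤ b →
  (∀ c → lo ≤ c → c < lo + n → f c ≡ v → g ≤ c × c < b) →
  count v (map f (interval lo n)) + g ≤ b
count-map-interval+≤ v f lo zero    g≤b hits = g≤b
count-map-interval+≤ v f lo (suc n) {g} {b} g≤b hits with f lo ≟ v
... | no  flo≢v = subst (λ x → x + g ≤ b) (sym (count-reject (map f (interval (suc lo) n)) flo≢v))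
                    (count-map-interval+≤ v f (suc lo) n g≤b hits′)
  where
  hits′ : ∀ c → suc lo ≤ c → c < suc lo + n → f c ≡ v → g ≤ c × c < b
  hits′ c lo<c c<end = hits c (<⇒≤ lo<c) (subst (c <_) (sym (+-suc lo n)) c<end)
... | yes flo≡v = begin
  count v (f lo ∷ rest) + g  ≡⟨ cong (_+ g) (count-accept rest flo≡v) ⟩
  suc (count v rest) + g     ≡⟨ sym (+-suc (count v rest) g) ⟩
  count v rest + suc g       ≤⟨ +-monoʳ-≤ (count v rest) (s≤s g≤lo) ⟩
  count v rest + suc lo      ≤⟨ count-map-interval+≤ v f (suc lo) n lo<b hits′ ⟩
  b                          ∎
  where
  open ≤-Reasoning
  rest = map f (interval (suc lo) n)
  hit-lo = hits lo ≤-refl (m<m+n lo z<s) flo≡v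
  g≤lo = proj₁ hit-lo
  lo<b = proj₂ hit-lo
  hits′ : ∀ c → suc lo ≤ c → c < suc lo + n → f c ≡ v → suc lo ≤ c × c < b
  hits′ c lo<c c<end fc≡v = lo<c , proj₂ (hits c (<⇒≤ lo<c) (subst (c <_) (sym (+-suc lo n)) c<end) fc≡v)

-- lo + n when no c ∈ [lo, lo + n) has u ≤ f c.
firstAtLeast : (ℕ → ℕ) → ℕ → ℕ → ℕ → ℕ
firstAtLeast f u lo zero    = lo
firstAtLeast f u lo (suc n) with u ≤? f lo
... | yes _ = lo
... | no  _ = firstAtLeast f u (suc lo) n

module _ (f : ℕ → ℕ) (u : ℕ) where

  lo≤firstAtLeast : ∀ lo n → lo ≤ firstAtLeast f u lo n
  lo≤firstAtLeast lo zero    = ≤-refl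
  lo≤firstAtLeast lo (suc n) with u ≤? f lo
  ... | yes _ = ≤-refl
  ... | no  _ = <⇒≤ (lo≤firstAtLeast (suc lo) n)

  firstAtLeast≤ : ∀ lo n → firstAtLeast f u lo n ≤ lo + n
  firstAtLeast≤ lo zero    = m≤m+n lo 0
  firstAtLeast≤ lo (suc n) with u ≤? f lo
  ... | yes _ = m≤m+n lo (suc n)
  ... | no  _ = subst (firstAtLeast f u (suc lo) n ≤_) (sym (+-suc lo n)) (firstAtLeast≤ (suc lo) n)

  <firstAtLeast⇒< : ∀ lo n {c} → lo ≤ c → c < firstAtLeast f u lo n → f c < u
  <firstAtLeast⇒< lo zero    lo≤c c<first = ⊥-elim (<⇒≱ c<first lo≤c)
  <firstAtLeast⇒< lo (suc n) lo≤c c<first with u ≤? f lo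
  ... | yes _   = ⊥-elim (<⇒≱ c<first lo≤c)
  ... | no  u≰f with m≤n⇒m<n∨m≡n lo≤c
  ...   | inj₁ lo<c  = <firstAtLeast⇒< (suc lo) n lo<c c<first
  ...   | inj₂ refl  = ≰⇒> u≰f

  firstAtLeast-≤ : ∀ lo n → firstAtLeast f u lo n < lo + n → u ≤ f (firstAtLeast f u lo n)
  firstAtLeast-≤ lo zero    first<end = ⊥-elim (<⇒≱ first<end (≤-reflexive (+-identityʳ lo)))
  firstAtLeast-≤ lo (suc n) first<end with u ≤? f lo
  ... | yes u≤f = u≤f
  ... | no  _   = firstAtLeast-≤ (suc lo) n (subst (firstAtLeast f u (suc lo) n <_) (+-suc lo n) first<end)

firstAtLeast-0 : ∀ f lo n → firstAtLeast f 0 lo n ≡ lo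
firstAtLeast-0 f lo zero    = refl
firstAtLeast-0 f lo (suc n) with 0 ≤? f lo
... | yes _   = refl
... | no  0≰f = ⊥-elim (0≰f z≤n)

get-beyond : ∀ xs {a} → length xs ≤ a → get xs a ≡ 0
get-beyond []       _         = refl
get-beyond (x ∷ xs) {suc a} (s≤s len≤a) = get-beyond xs len≤a

get-++ˡ : ∀ xs ys {m} → m < length xs → get (xs ++ ys) m ≡ get xs m
get-++ˡ (x ∷ xs) ys {zero}  _         = refl
get-++ˡ (x ∷ xs) ys {suc m} (s≤s m<n) = get-++ˡ xs ys m<n

get-++-length : ∀ xs ys → get (xs ++ ys) (length xs) ≡ get ys 0
get-++-length []       ys = refl
get-++-length (x ∷ xs) ys = get-++-length xs ys

get-reverse : ∀ xs {m} → m < length xs → get (reverse xs) m ≡ get xs (length xs ∸ suc m)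
get-reverse (x ∷ xs) {m} (s≤s m≤n) rewrite unfold-reverse x xs with m≤n⇒m<n∨m≡n m≤n
... | inj₁ m<n = begin
  get (reverse xs ++ [ x ]) m      ≡⟨ get-++ˡ (reverse xs) [ x ] (subst (m <_) (sym (length-reverse xs)) m<n) ⟩
  get (reverse xs) m               ≡⟨ get-reverse xs m<n ⟩
  get (x ∷ xs) (suc (length xs ∸ suc m)) ≡⟨ cong (get (x ∷ xs)) (sym (+-∸-assoc 1 m<n)) ⟩
  get (x ∷ xs) (length xs ∸ m)     ∎
  where open ≡-Reasoning
... | inj₂ refl = begin
  get (reverse xs ++ [ x ]) (length xs)               ≡⟨ cong (get (reverse xs ++ [ x ])) (sym (length-reverse xs)) ⟩
  get (reverse xs ++ [ x ]) (length (reverse xs))     ≡⟨ get-++-length (reverse xs) [ x ] ⟩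
  x                                                   ≡⟨ cong (get (x ∷ xs)) (sym (n∸n≡0 (length xs))) ⟩
  get (x ∷ xs) (length xs ∸ length xs)                ∎
  where open ≡-Reasoning

length-rhoAux : ∀ xs t → length (rhoAux xs t) ≡ length xs
length-rhoAux []       t = refl
length-rhoAux (x ∷ xs) t = cong suc (length-rhoAux xs (suc t))

get-rhoAux : ∀ xs t d → get (rhoAux xs t) d ≡ get xs d ∸ (t + d)
get-rhoAux []       t d       = sym (0∸n≡0 (t + d))
get-rhoAux (x ∷ xs) t zero    = cong (x ∸_) (sym (+-identityʳ t))
get-rhoAux (x ∷ xs) t (suc d) = trans (get-rhoAux xs (suc t) d) (cong (get xs d ∸_) (sym (+-suc t d)))

threshold⇒< : ∀ κ {s t m} → length κ ≤ s → t + suc m ≤ get κ m + s → m < s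
threshold⇒< κ {s} {t} {m} len≤s threshold = ≰⇒> λ s≤m →
  <⇒≱ (≤-trans (m≤n+m (suc m) t) (subst (λ x → t + suc m ≤ x + s) (get-beyond κ (≤-trans len≤s s≤m)) threshold)) s≤m

data IncreasingFrom : ℕ → List ℕ → Set where
  []  : ∀ {p} → IncreasingFrom p []
  _∷_ : ∀ {p x xs} → p ≤ x → IncreasingFrom (suc x) xs → IncreasingFrom p (x ∷ xs)

IncreasingFrom-weaken : ∀ {p q xs} → q ≤ p → IncreasingFrom p xs → IncreasingFrom q xs
IncreasingFrom-weaken q≤p []          = []
IncreasingFrom-weaken q≤p (p≤x ∷ inc) = ≤-trans q≤p p≤x ∷ inc

IncreasingFrom-get : ∀ {p xs} → IncreasingFrom p xs → ∀ {d} → d < length xs → p + d ≤ get xs d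
IncreasingFrom-get {p} (p≤x ∷ inc) {zero}  _         = subst (_≤ _) (sym (+-identityʳ p)) p≤x
IncreasingFrom-get {p} (p≤x ∷ inc) {suc d} (s≤s d<n) = begin
  p + suc d  ≡⟨ +-suc p d ⟩
  suc (p + d) ≤⟨ s≤s (+-monoˡ-≤ d p≤x) ⟩
  suc _ + d  ≤⟨ IncreasingFrom-get inc d<n ⟩
  _          ∎
  where open ≤-Reasoning

elemsFrom-increasing : ∀ {n} p (X : Subset n) → IncreasingFrom p (elemsFrom p X)
elemsFrom-increasing p []          = []
elemsFrom-increasing p (true ∷ X)  = ≤-refl ∷ elemsFrom-increasing (suc p) X
elemsFrom-increasing p (false ∷ X) = IncreasingFrom-weaken (n≤1+n p) (elemsFrom-increasing (suc p) X)

length-elemsFrom : ∀ {n} p (X : Subset n) → length (elemsFrom p X) ≡ ∣ X ∣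
length-elemsFrom p []          = refl
length-elemsFrom p (true ∷ X)  = cong suc (length-elemsFrom (suc p) X)
length-elemsFrom p (false ∷ X) = length-elemsFrom (suc p) X

get-elemsFrom< : ∀ {n} p (X : Subset n) {d} → d < length (elemsFrom p X) → get (elemsFrom p X) d < p + n
get-elemsFrom< {suc n} p (true ∷ X) {zero} _ = m<m+n p z<s
get-elemsFrom< {suc n} p (true ∷ X) {suc d} (s≤s d<len) =
  subst (get (elemsFrom (suc p) X) d <_) (sym (+-suc p n)) (get-elemsFrom< (suc p) X d<len)
get-elemsFrom< {suc n} p (false ∷ X) {d} d<len =
  subst (get (elemsFrom (suc p) X) d <_) (sym (+-suc p n)) (get-elemsFrom< (suc p) X d<len)

countAbove : ℕ → List ℕ → ℕ
countAbove t xs = length (filter (t <?_) xs)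

countAbove-accept : ∀ {t x} xs → t < x → countAbove t (x ∷ xs) ≡ suc (countAbove t xs)
countAbove-accept {t} xs t<x = cong length (filter-accept (t <?_) {xs = xs} t<x)

countAbove-reject : ∀ {t x} xs → t ≮ x → countAbove t (x ∷ xs) ≡ countAbove t xs
countAbove-reject {t} xs t≮x = cong length (filter-reject (t <?_) {xs = xs} t≮x)

countAbove-all : ∀ {p xs} t → IncreasingFrom p xs → t < p → countAbove t xs ≡ length xs
countAbove-all t []                         t<p = refl
countAbove-all t (_∷_ {xs = xs} p≤x inc) t<p = trans (countAbove-accept xs t<x) (cong suc (countAbove-all t inc (m<n⇒m<1+n t<x)))
  where t<x = <-≤-trans t<p p≤x

countAbove-suffix⇔ : ∀ {p xs} t → IncreasingFrom p xs → ∀ {d} → d < length xs →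
  length xs ∸ d ≤ countAbove t xs ⇔ t < get xs d
countAbove-suffix⇔ t inc d<n = mk⇔ (suffix⇒ inc d<n) (⇒suffix inc d<n)
  where
  ⇒suffix : ∀ {p xs} → IncreasingFrom p xs → ∀ {d} → d < length xs → t < get xs d → length xs ∸ d ≤ countAbove t xs
  ⇒suffix (_∷_ {xs = xs} _ inc) {zero} _ t<x =
    ≤-reflexive (sym (trans (countAbove-accept xs t<x) (cong suc (countAbove-all t inc (m<n⇒m<1+n t<x)))))
  ⇒suffix (_∷_ {x = x} {xs} _ inc) {suc d} (s≤s d<n) t<get with t <? x
  ... | yes t<x = ≤-trans (⇒suffix inc d<n t<get) (≤-trans (n≤1+n _) (≤-reflexive (sym (countAbove-accept xs t<x))))
  ... | no  t≮x = ≤-trans (⇒suffix inc d<n t<get) (≤-reflexive (sym (countAbove-reject xs t≮x)))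

  suffix⇒ : ∀ {p xs} → IncreasingFrom p xs → ∀ {d} → d < length xs → length xs ∸ d ≤ countAbove t xs → t < get xs d
  suffix⇒ (_∷_ {x = x} {xs} _ inc) {d} d<n suffix≤ with t <? x
  ... | yes t<x = <-≤-trans t<x (≤-trans (m≤m+n x d) (IncreasingFrom-get (≤-refl ∷ inc) d<n))
  suffix⇒ (_∷_ {xs = xs} _ inc) {zero} _ suffix≤ | no t≮x =
    ⊥-elim (<⇒≱ (s≤s (length-filter (t <?_) xs)) (≤-trans suffix≤ (≤-reflexive (countAbove-reject xs t≮x))))
  suffix⇒ (_∷_ {xs = xs} _ inc) {suc d} (s≤s d<n) suffix≤ | no t≮x =
    suffix⇒ inc d<n (≤-trans suffix≤ (≤-reflexive (countAbove-reject xs t≮x)))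

module Threshold {r s : ℕ} (X : Subset r) (|X|≡s : ∣ X ∣ ≡ s) where

  length-elems : length (elems X) ≡ s
  length-elems = trans (length-elemsFrom 1 X) |X|≡s

  length-ρ : length (ρ X) ≡ s
  length-ρ = trans (length-reverse (rhoAux (elems X) 1)) (trans (length-rhoAux (elems X) 1) length-elems)

  index<length : ∀ {m} → m < s → s ∸ suc m < length (elems X)
  index<length m<s = subst (_ <_) (sym length-elems) (∸-monoʳ-< z<s m<s)

  ρ+s≡ : ∀ {m} → m < s → get (ρ X) m + s ≡ get (elems X) (s ∸ suc m) + m
  ρ+s≡ {m} m<s = begin
    get (ρ X) m + s                   ≡⟨ cong (_+ s) ρ-entry ⟩
    (get e d ∸ suc d) + s             ≡⟨ cong ((get e d ∸ suc d) +_) s≡ ⟩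
    (get e d ∸ suc d) + (suc d + m)   ≡⟨ sym (+-assoc (get e d ∸ suc d) (suc d) m) ⟩
    (get e d ∸ suc d) + suc d + m     ≡⟨ cong (_+ m) (m∸n+n≡m suc-d≤entry) ⟩
    get e d + m                       ∎
    where
    open ≡-Reasoning
    e = elems X
    d = s ∸ suc m
    s≡ : s ≡ suc d + m
    s≡ = trans (sym (m∸n+n≡m m<s)) (+-suc d m)
    suc-d≤entry : suc d ≤ get e d
    suc-d≤entry = IncreasingFrom-get (elemsFrom-increasing 1 X) (index<length m<s)
    length-rhoAux-e : length (rhoAux e 1) ≡ s
    length-rhoAux-e = trans (length-rhoAux e 1) length-elems
    ρ-entry : get (ρ X) m ≡ get e d ∸ suc d
    ρ-entry = begin
      get (reverse (rhoAux e 1)) m                   ≡⟨ get-reverse (rhoAux e 1) (subst (m <_) (sym length-rhoAux-e) m<s) ⟩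
      get (rhoAux e 1) (length (rhoAux e 1) ∸ suc m) ≡⟨ cong (λ n → get (rhoAux e 1) (n ∸ suc m)) length-rhoAux-e ⟩
      get (rhoAux e 1) d                             ≡⟨ get-rhoAux e 1 d ⟩
      get e d ∸ suc d                                ∎

  suc≤countGt⇔ : ∀ {t m} → suc m ≤ countGt X t ⇔ t + suc m ≤ get (ρ X) m + s
  suc≤countGt⇔ {t} {m} = mk⇔ to from
    where
    suffix≡ : m < s → length (elems X) ∸ (s ∸ suc m) ≡ suc m
    suffix≡ m<s = trans (cong (_∸ (s ∸ suc m)) length-elems) (m∸[m∸n]≡n m<s)
    suffix⇔ : m < s → length (elems X) ∸ (s ∸ suc m) ≤ countGt X t ⇔ t < get (elems X) (s ∸ suc m)
    suffix⇔ m<s = countAbove-suffix⇔ t (elemsFrom-increasing 1 X) (index<length m<s)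

    to : suc m ≤ countGt X t → t + suc m ≤ get (ρ X) m + s
    to m<count = begin
      t + suc m                       ≡⟨ +-suc t m ⟩
      suc t + m                       ≤⟨ +-monoˡ-≤ m t<entry ⟩
      get (elems X) (s ∸ suc m) + m   ≡⟨ sym (ρ+s≡ m<s) ⟩
      get (ρ X) m + s                 ∎
      where
      open ≤-Reasoning
      m<s = <-≤-trans m<count (subst (countGt X t ≤_) length-elems (length-filter (t <?_) (elems X)))
      t<entry = Equivalence.to (suffix⇔ m<s) (subst (_≤ countGt X t) (sym (suffix≡ m<s)) m<count)

    from : t + suc m ≤ get (ρ X) m + s → suc m ≤ countGt X t
    from threshold = subst (_≤ countGt X t) (suffix≡ m<s) (Equivalence.from (suffix⇔ m<s) t<entry)
      where
      m<s = threshold⇒< (ρ X) (≤-reflexive length-ρ) threshold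
      t<entry : t < get (elems X) (s ∸ suc m)
      t<entry = +-cancelʳ-≤ m (suc t) _ (begin
        suc t + m                       ≡⟨ sym (+-suc t m) ⟩
        t + suc m                       ≤⟨ threshold ⟩
        get (ρ X) m + s                 ≡⟨ ρ+s≡ m<s ⟩
        get (elems X) (s ∸ suc m) + m   ∎)
        where open ≤-Reasoning

  ρ₀+s≤r : 0 < s → get (ρ X) 0 + s ≤ r
  ρ₀+s≤r 0<s = ≤-trans (≤-reflexive (trans (ρ+s≡ 0<s) (+-identityʳ _)))
                       (s≤s⁻¹ (get-elemsFrom< 1 X (index<length 0<s)))

module LRTableau {s : ℕ} {lam mu nu : List ℕ} {T : ℕ → ℕ → ℕ}
  (lam∈P : InP s lam) (mu∈P : InP s mu) (mu⊆lam : ∀ a → get mu a ≤ get lam a)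
  (isLR : IsLRTableau s lam mu nu T) where

  open IsLRTableau isLR

  L M : ℕ → ℕ
  L = get lam
  M = get mu

  W : List ℕ
  W = readingWord s lam mu T

  L-antitone : ∀ a → L (suc a) ≤ L a
  L-antitone = proj₂ lam∈P

  M-antitone : ∀ a → M (suc a) ≤ M a
  M-antitone = proj₂ mu∈P

  L-beyond : ∀ {a} → s ≤ a → L a ≡ 0
  L-beyond s≤a = get-beyond lam (≤-trans (proj₁ lam∈P) s≤a)

  row<s : ∀ {a c} → c < L a → a < s
  row<s c<L = ≰⇒> λ s≤a → n≮0 (subst (_ <_) (L-beyond s≤a) c<L)

  M+[L∸M]≡L : ∀ a → M a + (L a ∸ M a) ≡ L a
  M+[L∸M]≡L a = m+[n∸m]≡n (mu⊆lam a)

  row-mono : ∀ {a c c′} → M a ≤ c → c ≤′ c′ → c′ < L a → T a c ≤ T a c′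
  row-mono M≤c ≤′-refl c′<L = ≤-refl
  row-mono {a} {c} {suc c′} M≤c (≤′-step c≤c′) c′<L =
    ≤-trans (row-mono M≤c c≤c′ (<-trans (n<1+n c′) c′<L))
            (rowsWeak a c′ (row<s c′<L) (≤-trans M≤c (≤′⇒≤ c≤c′)) c′<L)

  rowCells : ℕ → List ℕ
  rowCells a = map (T a) (interval (M a) (L a ∸ M a))

  rowWord : ℕ → List ℕ
  rowWord a = reverse (map (T a) (range (M a) (L a)))

  rowWord≡ : ∀ a → rowWord a ≡ reverse (rowCells a)
  rowWord≡ a = cong (λ cs → reverse (map (T a) cs)) (range≡interval (M a) (L a))

  rowWord-beyond : ∀ {a} → s ≤ a → rowWord a ≡ []
  rowWord-beyond {a} s≤a = trans (rowWord≡ a) (cong (λ n → reverse (map (T a) (interval (M a) n))) no-cells)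
    where
    no-cells : L a ∸ M a ≡ 0
    no-cells = trans (cong (_∸ M a) (L-beyond s≤a)) (0∸n≡0 (M a))

  prefixWord : ℕ → List ℕ
  prefixWord A = concatMap rowWord (upTo A)

  prefixWord-suc : ∀ A → prefixWord (suc A) ≡ prefixWord A ++ rowWord A
  prefixWord-suc A = begin
    concatMap rowWord (upTo (suc A))     ≡⟨ cong (concatMap rowWord) (sym (upTo-∷ʳ A)) ⟩
    concatMap rowWord (upTo A ++ [ A ])  ≡⟨ concatMap-++ rowWord (upTo A) [ A ] ⟩
    prefixWord A ++ (rowWord A ++ [])    ≡⟨ cong (prefixWord A ++_) (++-identityʳ (rowWord A)) ⟩
    prefixWord A ++ rowWord A            ∎
    where open ≡-Reasoning

  prefixWord-beyond : ∀ {A} → s ≤′ A → prefixWord A ≡ W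
  prefixWord-beyond ≤′-refl = refl
  prefixWord-beyond {suc A} (≤′-step s≤A) = begin
    prefixWord (suc A)         ≡⟨ prefixWord-suc A ⟩
    prefixWord A ++ rowWord A  ≡⟨ cong (prefixWord A ++_) (rowWord-beyond (≤′⇒≤ s≤A)) ⟩
    prefixWord A ++ []         ≡⟨ ++-identityʳ (prefixWord A) ⟩
    prefixWord A               ≡⟨ prefixWord-beyond s≤A ⟩
    W                          ∎
    where open ≡-Reasoning

  prefixWord-extends : ∀ {A B} → A ≤′ B → ∃ λ rest → prefixWord B ≡ prefixWord A ++ rest
  prefixWord-extends {A} ≤′-refl = [] , sym (++-identityʳ (prefixWord A))
  prefixWord-extends {A} {suc B} (≤′-step A≤B) with prefixWord-extends A≤B
  ... | rest , B≡A++rest = rest ++ rowWord B , (begin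
    prefixWord (suc B)                   ≡⟨ prefixWord-suc B ⟩
    prefixWord B ++ rowWord B            ≡⟨ cong (_++ rowWord B) B≡A++rest ⟩
    (prefixWord A ++ rest) ++ rowWord B  ≡⟨ ++-assoc (prefixWord A) rest (rowWord B) ⟩
    prefixWord A ++ (rest ++ rowWord B)  ∎)
    where open ≡-Reasoning

  W-extends : ∀ A → ∃ λ rest → W ≡ prefixWord A ++ rest
  W-extends A with ≤-total A s
  ... | inj₁ A≤s = prefixWord-extends (≤⇒≤′ A≤s)
  ... | inj₂ s≤A = [] , trans (sym (prefixWord-beyond (≤⇒≤′ s≤A))) (sym (++-identityʳ (prefixWord A)))

  lattice-prefixWord : ∀ {v} A xs ys → suc v < s → prefixWord A ≡ xs ++ ys → count (suc v) xs ≤ count v xs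
  lattice-prefixWord {v} A xs ys v<s A≡xs++ys with W-extends A
  ... | rest , W≡ = subst (λ w → count (suc v) w ≤ count v w) take≡xs (lattice (length xs) v v<s)
    where
    open ≡-Reasoning
    take≡xs : take (length xs) W ≡ xs
    take≡xs = begin
      take (length xs) W                       ≡⟨ cong (take (length xs)) (trans W≡ (cong (_++ rest) A≡xs++ys)) ⟩
      take (length xs) ((xs ++ ys) ++ rest)    ≡⟨ cong (take (length xs)) (++-assoc xs ys rest) ⟩
      take (length xs) (xs ++ (ys ++ rest))    ≡⟨ take-length-++ xs (ys ++ rest) ⟩
      xs                                       ∎

  split : ℕ → ℕ → ℕ
  split u a = firstAtLeast (T a) u (M a) (L a ∸ M a)

  M≤split : ∀ u a → M a ≤ split u a
  M≤split u a = lo≤firstAtLeast (T a) u (M a) (L a ∸ M a)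

  split≤L : ∀ u a → split u a ≤ L a
  split≤L u a = subst (split u a ≤_) (M+[L∸M]≡L a) (firstAtLeast≤ (T a) u (M a) (L a ∸ M a))

  split-0 : ∀ a → split 0 a ≡ M a
  split-0 a = firstAtLeast-0 (T a) (M a) (L a ∸ M a)

  below-split : ∀ {u a c} → M a ≤ c → c < split u a → T a c < u
  below-split {u} {a} = <firstAtLeast⇒< (T a) u (M a) (L a ∸ M a)

  above-split : ∀ {u a c} → split u a ≤ c → c < L a → u ≤ T a c
  above-split {u} {a} split≤c c<L =
    ≤-trans (firstAtLeast-≤ (T a) u (M a) (L a ∸ M a) (subst (split u a <_) (sym (M+[L∸M]≡L a)) (≤-<-trans split≤c c<L)))
            (row-mono (M≤split u a) (≤⇒≤′ split≤c) c<L)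

  -- Column strictness: the entries ≥ u start weakly further left in the row below.
  split-antitone : ∀ u b → split u (suc b) ≤ split u b
  split-antitone u b = ≮⇒≥ λ c<split′ →
    let c<L′ = <-≤-trans c<split′ (split≤L u (suc b)) in
    <⇒≱ (begin-strict
           T b c        <⟨ colsStrict b c (row<s c<L′) (M≤split u b) M′≤c c<L′ ⟩
           T (suc b) c  <⟨ below-split M′≤c c<split′ ⟩
           u            ∎)
        (above-split ≤-refl (<-≤-trans c<L′ (L-antitone b)))
    where
    open ≤-Reasoning
    c = split u b
    M′≤c = ≤-trans (M-antitone b) (M≤split u b)

  split≤hit : ∀ {v a c} → M a ≤ c → T a c ≡ v → split v a ≤ c
  split≤hit M≤c refl = ≮⇒≥ λ c<split → <-irrefl refl (below-split M≤c c<split)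

  hit<split-above : ∀ {v b c} → M (suc b) ≤ c → c < L (suc b) → T (suc b) c ≡ v → c < split v b
  hit<split-above {v} {b} {c} M′≤c c<L′ refl with M b ≤? c
  ... | no  M≰c = <-≤-trans (≰⇒> M≰c) (M≤split v b)
  ... | yes M≤c = ≰⇒> λ split≤c →
    <⇒≱ (colsStrict b c (row<s c<L′) M≤c M′≤c c<L′) (above-split split≤c (<-≤-trans c<L′ (L-antitone b)))

  rowCount : ℕ → ℕ → ℕ
  rowCount v a = count v (rowCells a)

  rowCount+split≤L : ∀ v a → rowCount v a + split v a ≤ L a
  rowCount+split≤L v a = count-map-interval+≤ v (T a) (M a) (L a ∸ M a) (split≤L v a)
    λ c M≤c c<end T≡v → split≤hit M≤c T≡v , subst (c <_) (M+[L∸M]≡L a) c<end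

  rowCount+split≤split-above : ∀ v b → rowCount v (suc b) + split v (suc b) ≤ split v b
  rowCount+split≤split-above v b = count-map-interval+≤ v (T (suc b)) (M (suc b)) (L (suc b) ∸ M (suc b)) (split-antitone v b)
    λ c M≤c c<end T≡v → split≤hit M≤c T≡v , hit<split-above M≤c (subst (c <_) (M+[L∸M]≡L (suc b)) c<end) T≡v

  prefixCount : ℕ → ℕ → ℕ
  prefixCount v A = count v (prefixWord A)

  prefixCount-suc : ∀ v A → prefixCount v (suc A) ≡ prefixCount v A + rowCount v A
  prefixCount-suc v A = begin
    count v (prefixWord (suc A))            ≡⟨ cong (count v) (prefixWord-suc A) ⟩
    count v (prefixWord A ++ rowWord A)     ≡⟨ count-++ v (prefixWord A) (rowWord A) ⟩
    prefixCount v A + count v (rowWord A)   ≡⟨ cong (λ w → prefixCount v A + count v w) (rowWord≡ A) ⟩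
    prefixCount v A + count v (reverse (rowCells A)) ≡⟨ cong (prefixCount v A +_) (count-reverse v (rowCells A)) ⟩
    prefixCount v A + rowCount v A          ∎
    where open ≡-Reasoning

  -- The letters v in rows m … k, followed by the cells left of the split in row k, fit into row m.
  rowsFrom-count+split≤ : ∀ v {m k} → m ≤′ k → prefixCount v (suc k) + split v k ≤ prefixCount v m + L m
  rowsFrom-count+split≤ v {m} ≤′-refl = begin
    prefixCount v (suc m) + split v m              ≡⟨ cong (_+ split v m) (prefixCount-suc v m) ⟩
    prefixCount v m + rowCount v m + split v m     ≡⟨ +-assoc (prefixCount v m) (rowCount v m) (split v m) ⟩
    prefixCount v m + (rowCount v m + split v m)   ≤⟨ +-monoʳ-≤ (prefixCount v m) (rowCount+split≤L v m) ⟩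
    prefixCount v m + L m                          ∎
    where open ≤-Reasoning
  rowsFrom-count+split≤ v {m} {suc k} (≤′-step m≤k) = begin
    prefixCount v (suc (suc k)) + split v (suc k)                   ≡⟨ cong (_+ split v (suc k)) (prefixCount-suc v (suc k)) ⟩
    prefixCount v (suc k) + rowCount v (suc k) + split v (suc k)    ≡⟨ +-assoc (prefixCount v (suc k)) _ _ ⟩
    prefixCount v (suc k) + (rowCount v (suc k) + split v (suc k))  ≤⟨ +-monoʳ-≤ _ (rowCount+split≤split-above v k) ⟩
    prefixCount v (suc k) + split v k                               ≤⟨ rowsFrom-count+split≤ v m≤k ⟩
    prefixCount v m + L m                                           ∎
    where open ≤-Reasoning

  content≤ : ∀ {v} m → v < s → get nu v ≤ prefixCount v m + L m
  content≤ {v} m v<s = begin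
    get nu v                                        ≡⟨ sym (content v v<s) ⟩
    count v W                                       ≡⟨ cong (count v) (sym (prefixWord-beyond (≤⇒≤′ s≤suc[m+s]))) ⟩
    prefixCount v (suc (m + s))                     ≤⟨ m≤m+n _ (split v (m + s)) ⟩
    prefixCount v (suc (m + s)) + split v (m + s)   ≤⟨ rowsFrom-count+split≤ v (≤⇒≤′ (m≤m+n m s)) ⟩
    prefixCount v m + L m                           ∎
    where
    open ≤-Reasoning
    s≤suc[m+s] = m≤n⇒m≤1+n (m≤n+m s m)

  rowWord-split : ∀ u a → ∃₂ λ hi lo → rowWord a ≡ reverse hi ++ reverse lo × All (u ≤_) hi × All (_< u) lo
  rowWord-split u a = hiCells , loCells , row≡ , all-hi , all-lo
    where
    g = split u a
    loCells = map (T a) (interval (M a) (g ∸ M a))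
    hiCells = map (T a) (interval g (L a ∸ g))
    row≡ : rowWord a ≡ reverse hiCells ++ reverse loCells
    row≡ = begin
      rowWord a                      ≡⟨ rowWord≡ a ⟩
      reverse (rowCells a)           ≡⟨ cong (reverse ∘ map (T a)) (interval-split (M≤split u a) (split≤L u a)) ⟩
      reverse (map (T a) (interval (M a) (g ∸ M a) ++ interval g (L a ∸ g)))
                                     ≡⟨ cong reverse (map-++ (T a) (interval (M a) (g ∸ M a)) _) ⟩
      reverse (loCells ++ hiCells)   ≡⟨ reverse-++ loCells hiCells ⟩
      reverse hiCells ++ reverse loCells ∎
      where open ≡-Reasoning
    all-hi : All (u ≤_) hiCells
    all-hi = All-map-interval (T a) g (L a ∸ g)
      λ c g≤c c<end → above-split g≤c (subst (c <_) (m+[n∸m]≡n (split≤L u a)) c<end)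
    all-lo : All (_< u) loCells
    all-lo = All-map-interval (T a) (M a) (g ∸ M a)
      λ c M≤c c<end → below-split M≤c (subst (c <_) (m+[n∸m]≡n (M≤split u a)) c<end)

  -- The lattice condition, applied to the prefix of the reading word that stops inside row a
  -- just before its entries ≤ v.
  lattice-rows : ∀ {v} a → suc v < s → prefixCount (suc v) (suc a) ≤ prefixCount v a
  lattice-rows {v} a v<s with rowWord-split (suc v) a
  ... | hi , lo , row≡ , hi>v , lo≤v = begin
    prefixCount (suc v) (suc a)                   ≡⟨ cong (count (suc v)) prefix≡ ⟩
    count (suc v) (xs ++ reverse lo)              ≡⟨ count-++ (suc v) xs (reverse lo) ⟩
    count (suc v) xs + count (suc v) (reverse lo) ≡⟨ cong (count (suc v) xs +_) no-suc-v ⟩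
    count (suc v) xs + 0                          ≡⟨ +-identityʳ _ ⟩
    count (suc v) xs                              ≤⟨ lattice-prefixWord (suc a) xs (reverse lo) v<s prefix≡ ⟩
    count v xs                                    ≡⟨ count-++ v (prefixWord a) (reverse hi) ⟩
    prefixCount v a + count v (reverse hi)        ≡⟨ cong (prefixCount v a +_) no-v ⟩
    prefixCount v a + 0                           ≡⟨ +-identityʳ _ ⟩
    prefixCount v a                               ∎
    where
    open ≤-Reasoning
    xs = prefixWord a ++ reverse hi
    prefix≡ : prefixWord (suc a) ≡ xs ++ reverse lo
    prefix≡ = trans (prefixWord-suc a) (trans (cong (prefixWord a ++_) row≡) (sym (++-assoc (prefixWord a) (reverse hi) (reverse lo))))
    no-suc-v : count (suc v) (reverse lo) ≡ 0
    no-suc-v = trans (count-reverse (suc v) lo) (count-none (All.map <⇒≢ lo≤v))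
    no-v : count v (reverse hi) ≡ 0
    no-v = trans (count-reverse v hi) (count-none (All.map >⇒≢ hi>v))

  lattice-chain : ∀ p {q} → q < s → prefixCount q (q + p) ≤ prefixCount 0 p
  lattice-chain p {zero}  _   = ≤-refl
  lattice-chain p {suc q} q<s = ≤-trans (lattice-rows (q + p) q<s) (lattice-chain p (<-trans (n<1+n q) q<s))

  nu⊆lam : ∀ {q} → q < s → get nu q ≤ L q
  nu⊆lam {q} q<s = begin
    get nu q                    ≤⟨ content≤ q q<s ⟩
    prefixCount q q + L q       ≡⟨ cong (λ a → prefixCount q a + L q) (sym (+-identityʳ q)) ⟩
    prefixCount q (q + 0) + L q ≤⟨ +-monoˡ-≤ (L q) (lattice-chain 0 q<s) ⟩
    L q                         ∎
    where open ≤-Reasoning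

  mu+nu≤ : ∀ p {q} → q < s → M p + get nu q ≤ L 0 + L (q + suc p)
  mu+nu≤ p {q} q<s = begin
    M p + get nu q                                         ≤⟨ +-monoʳ-≤ (M p) (content≤ (q + suc p) q<s) ⟩
    M p + (prefixCount q (q + suc p) + L (q + suc p))      ≤⟨ +-monoʳ-≤ (M p) (+-monoˡ-≤ _ (lattice-chain (suc p) q<s)) ⟩
    M p + (prefixCount 0 (suc p) + L (q + suc p))          ≡⟨ sym (+-assoc (M p) _ _) ⟩
    M p + prefixCount 0 (suc p) + L (q + suc p)            ≡⟨ cong (_+ L (q + suc p)) (+-comm (M p) _) ⟩
    prefixCount 0 (suc p) + M p + L (q + suc p)            ≤⟨ +-monoˡ-≤ (L (q + suc p)) ones≤ ⟩
    L 0 + L (q + suc p)                                    ∎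
    where
    open ≤-Reasoning
    ones≤ : prefixCount 0 (suc p) + M p ≤ L 0
    ones≤ = subst (λ x → prefixCount 0 (suc p) + x ≤ L 0) (split-0 p) (rowsFrom-count+split≤ 0 (≤⇒≤′ z≤n))

threshold-mono : ∀ {i a m κ l s} → i ≤ a → a + suc m ≤ κ + s → κ ≤ l → i + suc m ≤ l + s
threshold-mono i≤a threshold κ≤l = ≤-trans (+-monoˡ-≤ _ i≤a) (≤-trans threshold (+-monoˡ-≤ _ κ≤l))

threshold-sum : ∀ {i j k p q μ ν l₀ l s} →
  i + k + suc p ≤ μ + s → i + j + suc q ≤ ν + s → μ + ν ≤ l₀ + l → l₀ + s ≤ i + j + k →
  i + suc (q + suc p) ≤ l + s
threshold-sum {i} {j} {k} {p} {q} {μ} {ν} {l₀} {l} {s} μ-threshold ν-threshold μ+ν≤ l₀+s≤ =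
  +-cancelˡ-≤ (i + j + k) _ _ (begin
    i + j + k + (i + suc (q + suc p))      ≡⟨ rearrange i j k p q ⟩
    (i + k + suc p) + (i + j + suc q)      ≤⟨ +-mono-≤ μ-threshold ν-threshold ⟩
    (μ + s) + (ν + s)                      ≡⟨ interchange μ s ν s ⟩
    (μ + ν) + (s + s)                      ≤⟨ +-monoˡ-≤ (s + s) μ+ν≤ ⟩
    (l₀ + l) + (s + s)                     ≡⟨ interchange l₀ l s s ⟩
    (l₀ + s) + (l + s)                     ≤⟨ +-monoˡ-≤ (l + s) l₀+s≤ ⟩
    i + j + k + (l + s)                    ∎)
  where
  open ≤-Reasoning
  rearrange : ∀ i j k p q → i + j + k + (i + suc (q + suc p)) ≡ (i + k + suc p) + (i + j + suc q)
  rearrange = solve-∀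

countGt-horn : ∀ {r s} (I J K : Subset r) → ∣ I ∣ ≡ s → ∣ J ∣ ≡ s → ∣ K ∣ ≡ s → LRConsistent s I J K →
  ∀ i j k → i + j + k ≡ r → countGt J (i + k) + countGt K (i + j) ≤ countGt I i
countGt-horn {s = s} I J K |I|≡s |J|≡s |K|≡s (lam∈P , mu∈P , _ , mu⊆lam , _ , isLR) i j k i+j+k≡r =
  by-cases (countGt J (i + k)) (countGt K (i + j)) ≤-refl ≤-refl
  where
  open LRTableau lam∈P mu∈P mu⊆lam isLR
  module ThI = Threshold I |I|≡s
  module ThJ = Threshold J |J|≡s
  module ThK = Threshold K |K|≡s

  I-from : ∀ {m} → i + suc m ≤ get (ρ I) m + s → suc m ≤ countGt I i
  I-from = Equivalence.from ThI.suc≤countGt⇔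
  J-to : ∀ {p} → suc p ≤ countGt J (i + k) → i + k + suc p ≤ get (ρ J) p + s
  J-to = Equivalence.to ThJ.suc≤countGt⇔
  K-to : ∀ {q} → suc q ≤ countGt K (i + j) → i + j + suc q ≤ get (ρ K) q + s
  K-to = Equivalence.to ThK.suc≤countGt⇔
  <s : ∀ {t q} → t + suc q ≤ get (ρ K) q + s → q < s
  <s = threshold⇒< (ρ K) (≤-reflexive ThK.length-ρ)

  by-cases : ∀ P Q → P ≤ countGt J (i + k) → Q ≤ countGt K (i + j) → P + Q ≤ countGt I i
  by-cases zero    zero    _   _   = z≤n
  by-cases (suc p) zero    p<J _   = subst (_≤ countGt I i) (sym (+-identityʳ (suc p)))
    (I-from (threshold-mono (m≤m+n i k) (J-to p<J) (mu⊆lam p)))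
  by-cases zero    (suc q) _   q<K = I-from (threshold-mono (m≤m+n i j) (K-to q<K) (nu⊆lam (<s (K-to q<K))))
  by-cases (suc p) (suc q) p<J q<K = subst (_≤ countGt I i) (+-comm (suc q) (suc p)) (I-from threshold)
    where
    q<s = <s (K-to q<K)
    0<s = threshold⇒< (ρ J) (≤-reflexive ThJ.length-ρ) (J-to (≤-trans (s≤s z≤n) p<J))
    L₀+s≤ : L 0 + s ≤ i + j + k
    L₀+s≤ = subst (L 0 + s ≤_) (sym i+j+k≡r) (ThI.ρ₀+s≤r 0<s)
    threshold : i + suc (q + suc p) ≤ L (q + suc p) + s
    threshold = threshold-sum {μ = M p} {ν = get (ρ K) q} {l₀ = L 0} {l = L (q + suc p)} {s = s}
                  (J-to p<J) (K-to q<K) (mu+nu≤ p q<s) L₀+s≤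

corollary8 : (r : ℕ) → 1 ≤ r → (s : ℕ) → (I J K : Subset r) →
    ∣ I ∣ ≡ s → ∣ J ∣ ≡ s → ∣ K ∣ ≡ s → LRConsistent s I J K →
    (i j k : ℕ) → i < r → j < r → k < r → i + j + k ≡ r →
    countGt I i ≥ countGt J (r ∸ j) + countGt K (r ∸ k)
corollary8 r _ s I J K |I|≡s |J|≡s |K|≡s consistent i j k _ _ _ i+j+k≡r =
  subst₂ (λ a b → countGt J a + countGt K b ≤ countGt I i) (sym r∸j≡i+k) (sym r∸k≡i+j)
    (countGt-horn I J K |I|≡s |J|≡s |K|≡s consistent i j k i+j+k≡r)
  where
  open ≡-Reasoning
  r∸j≡i+k : r ∸ j ≡ i + k
  r∸j≡i+k = begin
    r ∸ j          ≡⟨ cong (_∸ j) (sym i+j+k≡r) ⟩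
    i + j + k ∸ j  ≡⟨ cong (_∸ j) (xy∙z≈xz∙y i j k) ⟩
    i + k + j ∸ j  ≡⟨ m+n∸n≡m (i + k) j ⟩
    i + k          ∎
  r∸k≡i+j : r ∸ k ≡ i + j
  r∸k≡i+j = trans (cong (_∸ k) (sym i+j+k≡r)) (m+n∸n≡m (i + j) k)
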